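{- There is a constant $C$ such that for every $n$ and every set $T\subseteq V_n$, $\mathrm{xc}(P^{\uparrow}_{T\text{ -cut}}(n))\le C\, n^2\, 2^{|T|}$.
   Context: $K_n=(V_n,E_n)$ is the complete graph on $n$ nodes; $\delta(S)=\{\{u,w\}\in E_n: u\in S, w\notin S\}$. For $T\subseteq V_n$, a $T$-cut is a set $\delta(S)$ with $S\subseteq V_n$ and $|S\cap T|$ odd. The $T$-cut polyhedron is $P^{\uparrow}_{T\text{ -cut}}(n)=\mathrm{conv}\{\chi(C): C \text{ a } T\text{ -cut}\}+\mathbb{R}^{E_n}_+$. $\mathrm{xc}(P)$ is the extension complexity: the minimum number of facets of a polyhedron $Q$ such that $P=\pi(Q)$ for some linear map $\pi$.
   Formalization: The $T$-cut polyhedron, the polyhedron $Q$ and the linear map $\pi$ are taken over ℚ instead of ℝ. -}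

module Defs where

open import Data.Nat as ℕ using (ℕ; zero; suc; _%_)
open import Data.Fin as Fin using (Fin; zero; suc)
open import Data.Fin.Subset using (Subset; Side; inside; outside; _∩_; ∣_∣)
open import Data.Vec using (lookup)
open import Data.Rational as ℚ using (ℚ; 0ℚ; 1ℚ; _+_; _*_; _≤_)
open import Data.Product using (Σ; ∃; ∃-syntax; _×_; _,_)
open import Relation.Binary.PropositionalEquality using (_≡_)

sumFin : ∀ {k} → (Fin k → ℚ) → ℚ
sumFin {zero}  f = 0ℚ
sumFin {suc k} f = f zero + sumFin (λ i → f (suc i))

-- Edges of K_n: unordered pairs {i,j}, represented by i < j.
Edge : ℕ → Set
Edge n = Σ (Fin n) λ i → Σ (Fin n) λ j → i Fin.< j

EdgeVec : ℕ → Set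
EdgeVec n = Edge n → ℚ

Odd : ℕ → Set
Odd k = k % 2 ≡ 1

-- δ(S) is a T-cut iff |S ∩ T| is odd.
IsTCutShore : ∀ {n} → Subset n → Subset n → Set
IsTCutShore T S = Odd ∣ S ∩ T ∣

differ : Side → Side → ℚ
differ inside  inside  = 0ℚ
differ outside outside = 0ℚ
differ inside  outside = 1ℚ
differ outside inside  = 1ℚ

cutVec : ∀ {n} → Subset n → EdgeVec n
cutVec S (i , j , _) = differ (lookup S i) (lookup S j)

-- x ∈ P↑_{T-cut}(n) = conv{χ(C) : C a T-cut} + ℝ^{E_n}_+  (over ℚ):
-- x dominates a convex combination of finitely many T-cut vectors.
InTCutPolyhedron : ∀ n → Subset n → EdgeVec n → Set
InTCutPolyhedron n T x =
  ∃[ k ] Σ (Fin k → ℚ) λ λs → Σ (Fin k → Subset n) λ S →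
      (∀ i → 0ℚ ≤ λs i)
    × (sumFin λs ≡ 1ℚ)
    × (∀ i → IsTCutShore T (S i))
    × (∀ e → sumFin (λ i → λs i * cutVec (S i) e) ≤ x e)

record ExtFormulation (n : ℕ) : Set where
  field
    dim   : ℕ
    ineqs : ℕ
    eqs   : ℕ
    A     : Fin ineqs → Fin dim → ℚ
    b     : Fin ineqs → ℚ
    E     : Fin eqs → Fin dim → ℚ
    f     : Fin eqs → ℚ
    π     : Edge n → Fin dim → ℚ

  InQ : (Fin dim → ℚ) → Set
  InQ y = (∀ r → sumFin (λ j → A r j * y j) ≤ b r)
        × (∀ r → sumFin (λ j → E r j * y j) ≡ f r)

  proj : (Fin dim → ℚ) → EdgeVec n
  proj y e = sumFin (λ j → π e j * y j)

open ExtFormulation public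

Represents : ∀ {n} → ExtFormulation n → (EdgeVec n → Set) → Set
Represents F P =
  ∀ x → (P x → ∃[ y ] (InQ F y × (∀ e → proj F y e ≡ x e)))
      × (∀ y → InQ F y → P (proj F y))

-- xc(P) ≤ s : some extended formulation of P has at most s inequalities
-- (the number of facets of Q is at most its number of inequalities, and
-- conversely a polyhedron with f facets is described by f inequalities plus equations).
XcAtMost : ∀ {n} → (EdgeVec n → Set) → ℕ → Set
XcAtMost {n} P s = Σ (ExtFormulation n) λ F → Represents F P × (ineqs F ℕ.≤ s)

module Submission where

-- P↑_{T-cut}(n) is the convex hull of the union, over the 2^|T| possible traces U = S ∩ T, of the
-- dominants P_U of the T-cut vectors χ(δ(S)) with S ∩ T = U; these exist only for odd |U|.
-- For odd U, P_U is the projection onto x of {(d, x) : d ≥ 0, d = χ(U) on T, x_uw ≥ |d_u - d_w|}: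
-- the layer-cake decomposition writes d as a nonnegative combination, of total weight 1, of the
-- indicator vectors of its superlevel sets {v : d_v > τ}, 0 ≤ τ < 1. These sets all have trace U,
-- and the weights of those separating u from w add up to at most |d_u - d_w|. Balas' disjunctive
-- programming glues these systems into an extended formulation of the union: one homogenised copy
-- per trace, with the scales summing to 1, so 2^|T| · (2n² + n) inequalities in all.

open import Defs

open import Algebra.Bundles using (CommutativeRing)
open import Data.Bool using (_∧_)
open import Data.Bool.Properties using (∧-zeroʳ)
open import Data.Fin as Fin using (Fin; zero; suc; splitAt)
open import Data.Fin.Properties using (+↔⊎; *↔×; 1↔⊤; 2↔Bool; suc-injective; <-irrelevant)
open import Data.Fin.Subset using (Subset; Side; inside; outside; _∈_; _⊂_; _∩_; ∣_∣; Nonempty)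
open import Data.Fin.Subset.Induction using (⊂-wellFounded)
open import Data.Fin.Subset.Properties using (nonempty?; Empty-unique; ∣⊥∣≡0; x∈p∩q⁻)
open import Data.Integer using (+≤+; -≤+)
open import Data.List as List using (List; filter)
import Data.List.Extrema
open import Data.List.Membership.Propositional.Properties
  using (∈-filter⁺; ∈-filter⁻; ∈-tabulate⁺; ∈-tabulate⁻)
import Data.List.Relation.Unary.All as All
open import Data.Nat as ℕ using (ℕ; zero; suc; _^_; z≤n)
import Data.Nat.Properties as ℕ
open import Data.Nat.Tactic.RingSolver using (solve-∀)
open import Data.Product using (Σ; ∃-syntax; _×_; _,_; proj₁; proj₂)
open import Data.Product.Function.NonDependent.Propositional using (_×-↔_)
open import Data.Rational as ℚ using (ℚ; 0ℚ; 1ℚ; _+_; _*_; _-_; -_; _≤_; _<_; *≤*)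
open import Data.Rational.Properties
  using ( _<?_; ≤-refl; ≤-reflexive; ≤-trans; ≤-antisym; ≤-total; <⇒≤; ≮⇒≥; <-irrefl
        ; <-≤-trans; ≤-decTotalOrder; +-assoc; +-identityˡ; +-identityʳ; +-inverseʳ
        ; +-mono-≤; +-monoˡ-≤; +-monoʳ-≤; neg-distrib-+; neg-antimono-≤
        ; *-identityˡ; *-identityʳ; *-zeroˡ; *-zeroʳ; *-distribʳ-+
        ; *-monoʳ-≤-nonNeg; +-*-commutativeRing; module ≤-Reasoning )
open import Data.Rational.Solver using (module +-*-Solver)
open import Data.Sum using (_⊎_; inj₁; inj₂; [_,_])
open import Data.Sum.Function.Propositional using (_⊎-↔_)
open import Data.Sum.Properties using ([,]-map)
open import Data.Unit using (⊤; tt)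
open import Data.Vec using ([]; _∷_; lookup; tabulate; here; there)
import Data.Vec.Functional as Vector
open import Data.Vec.Properties using (lookup∘tabulate; lookup⇒[]=; []=⇒lookup)
open import Function using (_∘_; id; _↔_; Inverse)
open import Function.Construct.Composition using (_↔-∘_)
open import Function.Construct.Identity using (↔-id)
open import Induction.WellFounded using (Acc; acc)
open import Relation.Binary.Bundles using (DecTotalOrder)
open import Relation.Binary.PropositionalEquality hiding ([_])
open import Relation.Nullary using (Dec; yes; no; ¬_; contradiction)

open import Algebra.Properties.Semiring.Sum (CommutativeRing.semiring +-*-commutativeRing)
  using (sum; sum-cong-≗; ∑-distrib-+; ∑-comm; *-distribˡ-sum; sum-replicate-zero)

open +-*-Solver using (solve; _:+_; _:*_; _:-_; _:=_; con)

p≤q⇒p-q≤0 : ∀ {p q} → p ≤ q → p - q ≤ 0ℚ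
p≤q⇒p-q≤0 {p} {q} p≤q = subst (p - q ≤_) (+-inverseʳ q) (+-monoˡ-≤ (- q) p≤q)

p-q≤0⇒p≤q : ∀ {p q} → p - q ≤ 0ℚ → p ≤ q
p-q≤0⇒p≤q {p} {q} p-q≤0 =
  subst₂ _≤_ (solve 2 (λ p q → (p :- q) :+ q := p) refl p q) (+-identityˡ q) (+-monoˡ-≤ q p-q≤0)

p≤q⇒0≤q-p : ∀ {p q} → p ≤ q → 0ℚ ≤ q - p
p≤q⇒0≤q-p {p} {q} p≤q = subst (_≤ q - p) (+-inverseʳ p) (+-monoˡ-≤ (- p) p≤q)

p-q≡0⇒p≡q : ∀ {p q} → p - q ≡ 0ℚ → p ≡ q
p-q≡0⇒p≡q {p} {q} p-q≡0 =
  trans (solve 2 (λ p q → p := (p :- q) :+ q) refl p q) (trans (cong (_+ q) p-q≡0) (+-identityˡ q))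

p≤0⇒0≤q⇒p*q≤0 : ∀ {p q} → p ≤ 0ℚ → 0ℚ ≤ q → p * q ≤ 0ℚ
p≤0⇒0≤q⇒p*q≤0 {p} {q} p≤0 0≤q =
  subst (p * q ≤_) (*-zeroˡ q) (*-monoʳ-≤-nonNeg q {{ℚ.nonNegative 0≤q}} p≤0)

sumFin≡sum : ∀ {k} (f : Fin k → ℚ) → sumFin f ≡ sum f
sumFin≡sum {zero}  f = refl
sumFin≡sum {suc k} f = cong (f zero +_) (sumFin≡sum (f ∘ suc))

sumFin-cong : ∀ {k} {f g : Fin k → ℚ} → (∀ i → f i ≡ g i) → sumFin f ≡ sumFin g
sumFin-cong {f = f} {g} f≗g = trans (sumFin≡sum f) (trans (sum-cong-≗ f≗g) (sym (sumFin≡sum g)))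

sumFin-mono : ∀ {k} {f g : Fin k → ℚ} → (∀ i → f i ≤ g i) → sumFin f ≤ sumFin g
sumFin-mono {zero}  f≤g = ≤-refl
sumFin-mono {suc k} f≤g = +-mono-≤ (f≤g zero) (sumFin-mono (f≤g ∘ suc))

sumFin-zero : ∀ {k} → sumFin {k} (λ _ → 0ℚ) ≡ 0ℚ
sumFin-zero {k} = trans (sumFin≡sum {k} (λ _ → 0ℚ)) (sum-replicate-zero k)

sumFin-+ : ∀ {k} (f g : Fin k → ℚ) → sumFin (λ i → f i + g i) ≡ sumFin f + sumFin g
sumFin-+ f g =
  trans (sumFin≡sum (λ i → f i + g i))
        (trans (∑-distrib-+ f g) (sym (cong₂ _+_ (sumFin≡sum f) (sumFin≡sum g))))

sumFin-neg : ∀ {k} (f : Fin k → ℚ) → sumFin (λ i → - f i) ≡ - sumFin f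
sumFin-neg {zero}  f = refl
sumFin-neg {suc k} f =
  trans (cong (- f zero +_) (sumFin-neg (f ∘ suc))) (sym (neg-distrib-+ (f zero) (sumFin (f ∘ suc))))

sumFin-- : ∀ {k} (f g : Fin k → ℚ) → sumFin (λ i → f i - g i) ≡ sumFin f - sumFin g
sumFin-- f g = trans (sumFin-+ f (λ i → - g i)) (cong (sumFin f +_) (sumFin-neg g))

sumFin-*ˡ : ∀ {k} q (f : Fin k → ℚ) → sumFin (λ i → q * f i) ≡ q * sumFin f
sumFin-*ˡ q f =
  trans (sumFin≡sum (λ i → q * f i)) (trans (sym (*-distribˡ-sum q f)) (cong (q *_) (sym (sumFin≡sum f))))

sumFin-comm : ∀ {k l} (F : Fin k → Fin l → ℚ) →
  sumFin (λ i → sumFin (F i)) ≡ sumFin (λ j → sumFin (λ i → F i j))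
sumFin-comm F = trans (sumFin²≡sum² F) (trans (∑-comm F) (sym (sumFin²≡sum² (λ j i → F i j))))
  where
  sumFin²≡sum² : ∀ {k l} (G : Fin k → Fin l → ℚ) →
    sumFin (λ i → sumFin (G i)) ≡ sum (λ i → sum (G i))
  sumFin²≡sum² G = trans (sumFin≡sum (λ i → sumFin (G i))) (sum-cong-≗ (λ i → sumFin≡sum (G i)))

sumFin-single : ∀ {k} (f : Fin k → ℚ) j → (∀ i → i ≢ j → f i ≡ 0ℚ) → sumFin f ≡ f j
sumFin-single {suc k} f zero    f≡0 =
  trans (cong (f zero +_) (trans (sumFin-cong (λ i → f≡0 (suc i) (λ ()))) (sumFin-zero {k})))
        (+-identityʳ (f zero))
sumFin-single {suc k} f (suc j) f≡0 =
  trans (cong (_+ sumFin (f ∘ suc)) (f≡0 zero (λ ())))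
        (trans (+-identityˡ _) (sumFin-single (f ∘ suc) j (λ i i≢j → f≡0 (suc i) (i≢j ∘ suc-injective))))

δ : ∀ {k} → Fin k → Fin k → ℚ
δ i j with i Fin.≟ j
... | yes _ = 1ℚ
... | no  _ = 0ℚ

sumFin-δ : ∀ {k} (i : Fin k) (y : Fin k → ℚ) → sumFin (λ j → δ i j * y j) ≡ y i
sumFin-δ i y = trans (sumFin-single _ i off-diagonal) diagonal
  where
  off-diagonal : ∀ j → j ≢ i → δ i j * y j ≡ 0ℚ
  off-diagonal j j≢i with i Fin.≟ j
  ... | yes i≡j = contradiction (sym i≡j) j≢i
  ... | no  _   = *-zeroˡ (y j)
  diagonal : δ i i * y i ≡ y i
  diagonal with i Fin.≟ i
  ... | yes _   = *-identityˡ (y i)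
  ... | no  i≢i = contradiction refl i≢i

sumFin-++ : ∀ {k l} (f : Fin k → ℚ) (g : Fin l → ℚ) → sumFin (f Vector.++ g) ≡ sumFin f + sumFin g
sumFin-++ {zero}  f g = sym (+-identityˡ (sumFin g))
sumFin-++ {suc k} f g =
  trans (cong (f zero +_) (trans (sumFin-cong ([,]-map ∘ splitAt k)) (sumFin-++ (f ∘ suc) g)))
        (sym (+-assoc (f zero) (sumFin (f ∘ suc)) (sumFin g)))

++-pointwise : ∀ {A : Set} {P : A → Set} {k l} {f : Fin k → A} {g : Fin l → A} →
  (∀ i → P (f i)) → (∀ i → P (g i)) → ∀ i → P ((f Vector.++ g) i)
++-pointwise {P = P} {k} {f = f} {g} Pf Pg i = [_,_] {C = λ s → P ([ f , g ] s)} Pf Pg (splitAt k i)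

++-zipWith : ∀ {A B C : Set} (_∙_ : A → B → C) {k l}
  (f : Fin k → A) (g : Fin l → A) (F : Fin k → B) (G : Fin l → B) →
  ∀ i → (f Vector.++ g) i ∙ (F Vector.++ G) i ≡ ((λ j → f j ∙ F j) Vector.++ (λ j → g j ∙ G j)) i
++-zipWith _∙_ {k} f g F G i =
  [_,_] {C = λ s → [ f , g ] s ∙ [ F , G ] s ≡ [ (λ j → f j ∙ F j) , (λ j → g j ∙ G j) ] s}
    (λ _ → refl) (λ _ → refl) (splitAt k i)

record Enumeration (A : Set) : Set where
  field
    size     : ℕ
    indexing : Fin size ↔ A

  element : Fin size → A
  element = Inverse.to indexing

  index : A → Fin size
  index = Inverse.from indexing

  element-index : ∀ a → element (index a) ≡ a
  element-index = Inverse.strictlyInverseˡ indexing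

open Enumeration public

enumFin : ∀ m → Enumeration (Fin m)
enumFin m = record { size = m ; indexing = ↔-id (Fin m) }

enum⊤ : Enumeration ⊤
enum⊤ = record { size = 1 ; indexing = 1↔⊤ }

infixr 1 _⊎ₑ_
infixr 2 _×ₑ_

_⊎ₑ_ : ∀ {A B} → Enumeration A → Enumeration B → Enumeration (A ⊎ B)
EA ⊎ₑ EB = record
  { size     = size EA ℕ.+ size EB
  ; indexing = (indexing EA ⊎-↔ indexing EB) ↔-∘ +↔⊎
  }

_×ₑ_ : ∀ {A B} → Enumeration A → Enumeration B → Enumeration (A × B)
EA ×ₑ EB = record
  { size     = size EA ℕ.* size EB
  ; indexing = (indexing EA ×-↔ indexing EB) ↔-∘ *↔×
  }

infixl 6 _⊕_ _⊖_

data LinearForm (V : Set) : Set where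
  0ₗ      : LinearForm V
  var     : V → LinearForm V
  _⊕_ _⊖_ : LinearForm V → LinearForm V → LinearForm V

rename : ∀ {V W : Set} → (V → W) → LinearForm V → LinearForm W
rename σ 0ₗ      = 0ₗ
rename σ (var v) = var (σ v)
rename σ (f ⊕ g) = rename σ f ⊕ rename σ g
rename σ (f ⊖ g) = rename σ f ⊖ rename σ g

module _ {V : Set} where

  eval : (V → ℚ) → LinearForm V → ℚ
  eval Y 0ₗ      = 0ℚ
  eval Y (var v) = Y v
  eval Y (f ⊕ g) = eval Y f + eval Y g
  eval Y (f ⊖ g) = eval Y f - eval Y g

  Σₗ : ∀ {k} → (Fin k → LinearForm V) → LinearForm V
  Σₗ {zero}  f = 0ₗ
  Σₗ {suc k} f = f zero ⊕ Σₗ (f ∘ suc)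

  eval-Σₗ : ∀ Y {k} (f : Fin k → LinearForm V) → eval Y (Σₗ f) ≡ sumFin (λ i → eval Y (f i))
  eval-Σₗ Y {zero}  f = refl
  eval-Σₗ Y {suc k} f = cong (eval Y (f zero) +_) (eval-Σₗ Y (f ∘ suc))

  eval-cong : ∀ {Y Z : V → ℚ} → (∀ v → Y v ≡ Z v) → ∀ f → eval Y f ≡ eval Z f
  eval-cong Y≗Z 0ₗ      = refl
  eval-cong Y≗Z (var v) = Y≗Z v
  eval-cong Y≗Z (f ⊕ g) = cong₂ _+_ (eval-cong Y≗Z f) (eval-cong Y≗Z g)
  eval-cong Y≗Z (f ⊖ g) = cong₂ _-_ (eval-cong Y≗Z f) (eval-cong Y≗Z g)

  eval-linear : ∀ {k} (Y : Fin k → V → ℚ) (c : Fin k → ℚ) f →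
    eval (λ v → sumFin (λ i → Y i v * c i)) f ≡ sumFin (λ i → eval (Y i) f * c i)
  eval-linear {k} Y c 0ₗ      = sym (trans (sumFin-cong (λ i → *-zeroˡ (c i))) (sumFin-zero {k}))
  eval-linear {k} Y c (var v) = refl
  eval-linear {k} Y c (f ⊕ g) = begin
    eval _ f + eval _ g
      ≡⟨ cong₂ _+_ (eval-linear Y c f) (eval-linear Y c g) ⟩
    sumFin (λ i → eval (Y i) f * c i) + sumFin (λ i → eval (Y i) g * c i)
      ≡⟨ sumFin-+ {k} _ _ ⟨
    sumFin (λ i → eval (Y i) f * c i + eval (Y i) g * c i)
      ≡⟨ sumFin-cong (λ i → *-distribʳ-+ (c i) (eval (Y i) f) (eval (Y i) g)) ⟨
    sumFin (λ i → eval (Y i) (f ⊕ g) * c i) ∎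
    where open ≡-Reasoning
  eval-linear {k} Y c (f ⊖ g) = begin
    eval _ f - eval _ g
      ≡⟨ cong₂ _-_ (eval-linear Y c f) (eval-linear Y c g) ⟩
    sumFin (λ i → eval (Y i) f * c i) - sumFin (λ i → eval (Y i) g * c i)
      ≡⟨ sumFin-- {k} _ _ ⟨
    sumFin (λ i → eval (Y i) f * c i - eval (Y i) g * c i)
      ≡⟨ sumFin-cong (λ i → *-distribʳ-- (c i) (eval (Y i) f) (eval (Y i) g)) ⟨
    sumFin (λ i → eval (Y i) (f ⊖ g) * c i) ∎
    where
    open ≡-Reasoning
    *-distribʳ-- : ∀ r p q → (p - q) * r ≡ p * r - q * r
    *-distribʳ-- = solve 3 (λ r p q → (p :- q) :* r := p :* r :- q :* r) refl

eval-rename : ∀ {V W : Set} (Y : W → ℚ) (σ : V → W) f → eval Y (rename σ f) ≡ eval (Y ∘ σ) f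
eval-rename Y σ 0ₗ      = refl
eval-rename Y σ (var v) = refl
eval-rename Y σ (f ⊕ g) = cong₂ _+_ (eval-rename Y σ f) (eval-rename Y σ g)
eval-rename Y σ (f ⊖ g) = cong₂ _-_ (eval-rename Y σ f) (eval-rename Y σ g)

module _ {V : Set} (E : Enumeration V) where

  coeff : LinearForm V → Fin (size E) → ℚ
  coeff f j = eval (λ v → δ (index E v) j) f

  coeff-eval : ∀ (y : Fin (size E) → ℚ) f → sumFin (λ j → coeff f j * y j) ≡ eval (y ∘ index E) f
  coeff-eval y f = trans (sym (eval-linear {k = size E} _ y f)) (eval-cong (λ v → sumFin-δ (index E v) y) f)

  coeff-eval-element : ∀ (Y : V → ℚ) f → sumFin (λ j → coeff f j * Y (element E j)) ≡ eval Y f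
  coeff-eval-element Y f = trans (coeff-eval (Y ∘ element E) f) (eval-cong (cong Y ∘ element-index E) f)

record Formulation (n : ℕ) : Set₁ where
  field
    Variable Inequality Equation : Set
    variables    : Enumeration Variable
    inequalities : Enumeration Inequality
    equations    : Enumeration Equation
    ineqForm     : Inequality → LinearForm Variable
    ineqBound    : Inequality → ℚ
    eqForm       : Equation → LinearForm Variable
    eqValue      : Equation → ℚ
    image        : Edge n → LinearForm Variable

  Feasible : (Variable → ℚ) → Set
  Feasible Y = (∀ r → eval Y (ineqForm r) ≤ ineqBound r) × (∀ r → eval Y (eqForm r) ≡ eqValue r)

  project : (Variable → ℚ) → EdgeVec n
  project Y e = eval Y (image e)

  extFormulation : ExtFormulation n
  extFormulation = record
    { dim   = size variables
    ; ineqs = size inequalities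
    ; eqs   = size equations
    ; A     = coeff variables ∘ ineqForm ∘ element inequalities
    ; b     = ineqBound ∘ element inequalities
    ; E     = coeff variables ∘ eqForm ∘ element equations
    ; f     = eqValue ∘ element equations
    ; π     = coeff variables ∘ image
    }

  represents : {P : EdgeVec n → Set} →
    (∀ {x x′} → (∀ e → x e ≡ x′ e) → P x → P x′) →
    (∀ x → P x → ∃[ Y ] Feasible Y × (∀ e → project Y e ≡ x e)) →
    (∀ Y → Feasible Y → P (project Y)) →
    Represents extFormulation P
  represents {P} P-resp complete sound x = lift , descend
    where
    lift : P x → ∃[ y ] InQ extFormulation y × (∀ e → proj extFormulation y e ≡ x e)
    lift Px with complete x Px
    ... | Y , (ineqs-hold , eqs-hold) , projects = Y ∘ element variables , (rows≤ , rows≡) , projects′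
      where
      rows≤ : ∀ i → sumFin (λ j → coeff variables (ineqForm (element inequalities i)) j * Y (element variables j))
                  ≤ ineqBound (element inequalities i)
      rows≤ i = subst (_≤ _) (sym (coeff-eval-element variables Y (ineqForm (element inequalities i))))
                  (ineqs-hold (element inequalities i))
      rows≡ : ∀ i → sumFin (λ j → coeff variables (eqForm (element equations i)) j * Y (element variables j))
                  ≡ eqValue (element equations i)
      rows≡ i = trans (coeff-eval-element variables Y (eqForm (element equations i)))
                      (eqs-hold (element equations i))
      projects′ : ∀ e → proj extFormulation (Y ∘ element variables) e ≡ x e
      projects′ e = trans (coeff-eval-element variables Y (image e)) (projects e)

    descend : ∀ y → InQ extFormulation y → P (proj extFormulation y)
    descend y (rows≤ , rows≡) =
      P-resp (λ e → sym (coeff-eval variables y (image e))) (sound Y (ineqs-hold , eqs-hold))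
      where
      Y : Variable → ℚ
      Y = y ∘ index variables
      row≤ : ∀ i → eval Y (ineqForm (element inequalities i)) ≤ ineqBound (element inequalities i)
      row≤ i = subst (_≤ _) (coeff-eval variables y (ineqForm (element inequalities i))) (rows≤ i)
      row≡ : ∀ i → eval Y (eqForm (element equations i)) ≡ eqValue (element equations i)
      row≡ i = trans (sym (coeff-eval variables y (eqForm (element equations i)))) (rows≡ i)
      ineqs-hold : ∀ r → eval Y (ineqForm r) ≤ ineqBound r
      ineqs-hold r = subst (λ r → eval Y (ineqForm r) ≤ ineqBound r) (element-index inequalities r)
                           (row≤ (index inequalities r))
      eqs-hold : ∀ r → eval Y (eqForm r) ≡ eqValue r
      eqs-hold r = subst (λ r → eval Y (eqForm r) ≡ eqValue r) (element-index equations r)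
                         (row≡ (index equations r))

positive? : ℚ → Side
positive? q with 0ℚ <? q
... | yes _ = inside
... | no  _ = outside

positive?-pos : ∀ {q} → 0ℚ < q → positive? q ≡ inside
positive?-pos {q} 0<q with 0ℚ <? q
... | yes _   = refl
... | no  0≮q = contradiction 0<q 0≮q

positive?-nonpos : ∀ {q} → ¬ 0ℚ < q → positive? q ≡ outside
positive?-nonpos {q} 0≮q with 0ℚ <? q
... | yes 0<q = contradiction 0<q 0≮q
... | no  _   = refl

positives : ∀ {n} → (Fin n → ℚ) → Subset n
positives d = tabulate (positive? ∘ d)

module _ {n} {d : Fin n → ℚ} where

  lookup-positives : ∀ v → lookup (positives d) v ≡ positive? (d v)
  lookup-positives = lookup∘tabulate (positive? ∘ d)

  ∈-positives⁺ : ∀ {v} → 0ℚ < d v → v ∈ positives d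
  ∈-positives⁺ {v} 0<dv = lookup⇒[]= v (positives d) (trans (lookup-positives v) (positive?-pos 0<dv))

  ∈-positives⁻ : ∀ {v} → v ∈ positives d → 0ℚ < d v
  ∈-positives⁻ {v} v∈ with 0ℚ <? d v | trans (sym (lookup-positives v)) ([]=⇒lookup v∈)
  ... | yes 0<dv | _ = 0<dv
  ... | no  _    | ()

lowerBy : ℚ → ℚ → ℚ
lowerBy t q with 0ℚ <? q
... | yes _ = q - t
... | no  _ = 0ℚ

lowerBy-pos : ∀ {t q} → 0ℚ < q → lowerBy t q ≡ q - t
lowerBy-pos {t} {q} 0<q with 0ℚ <? q
... | yes _   = refl
... | no  0≮q = contradiction 0<q 0≮q

lowerBy-nonpos : ∀ {t q} → ¬ 0ℚ < q → lowerBy t q ≡ 0ℚ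
lowerBy-nonpos {t} {q} 0≮q with 0ℚ <? q
... | yes 0<q = contradiction 0<q 0≮q
... | no  _   = refl

lowerBy-pos⁻¹ : ∀ {t q} → 0ℚ < lowerBy t q → 0ℚ < q
lowerBy-pos⁻¹ {t} {q} 0<lowered with 0ℚ <? q
... | yes 0<q = 0<q
... | no  _   = contradiction 0<lowered (<-irrefl refl)

lowerBy-⊂ : ∀ {n t v} {d : Fin n → ℚ} → 0ℚ < d v → d v ≡ t →
  positives (lowerBy t ∘ d) ⊂ positives d
lowerBy-⊂ {t = t} {v} {d} 0<dv dv≡t =
  ∈-positives⁺ ∘ lowerBy-pos⁻¹ ∘ ∈-positives⁻ , v , ∈-positives⁺ 0<dv ,
  λ v∈ → <-irrefl (sym lowered-to-0) (∈-positives⁻ v∈)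
  where
  lowered-to-0 : lowerBy t (d v) ≡ 0ℚ
  lowered-to-0 = trans (lowerBy-pos 0<dv) (trans (cong (λ r → d v - r) (sym dv≡t)) (+-inverseʳ (d v)))

peel-separation : ∀ {t p q σ} → (0ℚ < p → t ≤ p) → q ≤ p →
  (lowerBy t q ≤ lowerBy t p → σ ≤ lowerBy t p - lowerBy t q) →
  t * differ (positive? p) (positive? q) + σ ≤ p - q
peel-separation {t} {p} {q} {σ} t≤p q≤p rest with 0ℚ <? p | 0ℚ <? q
... | yes 0<p | yes 0<q = begin
  t * 0ℚ + σ        ≡⟨ trans (cong (_+ σ) (*-zeroʳ t)) (+-identityˡ σ) ⟩
  σ                 ≤⟨ rest (+-monoˡ-≤ (- t) q≤p) ⟩
  (p - t) - (q - t) ≡⟨ solve 3 (λ p q t → (p :- t) :- (q :- t) := p :- q) refl p q t ⟩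
  p - q             ∎
  where open ≤-Reasoning
... | yes 0<p | no 0≮q = begin
  t * 1ℚ + σ              ≤⟨ +-monoʳ-≤ (t * 1ℚ) (rest (p≤q⇒0≤q-p (t≤p 0<p))) ⟩
  t * 1ℚ + ((p - t) - 0ℚ) ≡⟨ solve 2 (λ t p → t :* con 1ℚ :+ ((p :- t) :- con 0ℚ) := p :- con 0ℚ) refl t p ⟩
  p - 0ℚ                  ≤⟨ +-monoʳ-≤ p (neg-antimono-≤ (≮⇒≥ 0≮q)) ⟩
  p - q                   ∎
  where open ≤-Reasoning
... | no 0≮p | yes 0<q = contradiction (<-≤-trans 0<q q≤p) 0≮p
... | no 0≮p | no 0≮q = begin
  t * 0ℚ + σ ≡⟨ trans (cong (_+ σ) (*-zeroʳ t)) (+-identityˡ σ) ⟩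
  σ          ≤⟨ rest ≤-refl ⟩
  0ℚ - 0ℚ    ≡⟨ +-inverseʳ 0ℚ ⟩
  0ℚ         ≤⟨ p≤q⇒0≤q-p q≤p ⟩
  p - q      ∎
  where open ≤-Reasoning

-- d = Σᵢ weight i · χ(layer i) with the layers superlevel sets of d; only the consequences
-- needed below are recorded.
record LevelDecomposition {n : ℕ} (s : ℚ) (d : Fin n → ℚ) : Set where
  field
    depth         : ℕ
    weight        : Fin depth → ℚ
    layer         : Fin depth → Subset n
    weight-nonneg : ∀ i → 0ℚ ≤ weight i
    weight-sum    : sumFin weight ≡ s
    top∈layer     : ∀ i {v} → d v ≡ s → lookup (layer i) v ≡ inside
    bottom∉layer  : ∀ i {v} → d v ≡ 0ℚ → lookup (layer i) v ≡ outside
    separation    : ∀ {u w} → d w ≤ d u →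
      sumFin (λ i → weight i * differ (lookup (layer i) u) (lookup (layer i) w)) ≤ d u - d w

emptyDecomposition : ∀ {n} {d : Fin n → ℚ} → LevelDecomposition 0ℚ d
emptyDecomposition = record
  { depth         = 0
  ; weight        = λ ()
  ; layer         = λ ()
  ; weight-nonneg = λ ()
  ; weight-sum    = refl
  ; top∈layer     = λ ()
  ; bottom∉layer  = λ ()
  ; separation    = p≤q⇒0≤q-p
  }

module _ {n} {s t : ℚ} {d : Fin n → ℚ}
  (0<t : 0ℚ < t) (t≤s : t ≤ s) (t≤d : ∀ {v} → 0ℚ < d v → t ≤ d v) where

  peelLayer : LevelDecomposition (s - t) (lowerBy t ∘ d) → LevelDecomposition s d
  peelLayer D = record
    { depth         = suc depth
    ; weight        = t Vector.∷ weight
    ; layer         = positives d Vector.∷ layer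
    ; weight-nonneg = λ { zero → <⇒≤ 0<t ; (suc i) → weight-nonneg i }
    ; weight-sum    = trans (cong (t +_) weight-sum) (solve 2 (λ t s → t :+ (s :- t) := s) refl t s)
    ; top∈layer     = top
    ; bottom∉layer  = bottom
    ; separation    = λ {u} {w} dw≤du →
        subst₂ (λ a b → t * differ a b + _ ≤ d u - d w)
          (sym (lookup-positives u)) (sym (lookup-positives w)) (peel-separation t≤d dw≤du separation)
    }
    where
    open LevelDecomposition D

    0<top : ∀ {v} → d v ≡ s → 0ℚ < d v
    0<top dv≡s = subst (0ℚ <_) (sym dv≡s) (<-≤-trans 0<t t≤s)

    top : ∀ i {v} → d v ≡ s → lookup ((positives d Vector.∷ layer) i) v ≡ inside
    top zero    {v} dv≡s = trans (lookup-positives v) (positive?-pos (0<top dv≡s))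
    top (suc i) {v} dv≡s = top∈layer i (trans (lowerBy-pos (0<top dv≡s)) (cong (_- t) dv≡s))

    bottom : ∀ i {v} → d v ≡ 0ℚ → lookup ((positives d Vector.∷ layer) i) v ≡ outside
    bottom zero    {v} dv≡0 = trans (lookup-positives v) (positive?-nonpos (<-irrefl (sym dv≡0)))
    bottom (suc i) {v} dv≡0 = bottom∉layer i (lowerBy-nonpos (<-irrefl (sym dv≡0)))

module _ {n} (s : ℚ) (d : Fin n → ℚ) where

  private
    module Min = Data.List.Extrema (DecTotalOrder.totalOrder ≤-decTotalOrder)

    positiveValues : List ℚ
    positiveValues = filter (0ℚ <?_) (List.tabulate d)

  lowest : ℚ
  lowest = Min.min s positiveValues

  lowest≤ : lowest ≤ s
  lowest≤ = Min.min≤⊤ s positiveValues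

  lowest≤positive : ∀ {v} → 0ℚ < d v → lowest ≤ d v
  lowest≤positive {v} 0<dv =
    All.lookup (Min.min≤xs s positiveValues) (∈-filter⁺ (0ℚ <?_) (∈-tabulate⁺ v) 0<dv)

  lowest-sel : lowest ≡ s ⊎ ∃[ v ] 0ℚ < d v × lowest ≡ d v
  lowest-sel with Min.argmin-sel id s positiveValues
  ... | inj₁ lowest≡s = inj₁ lowest≡s
  ... | inj₂ lowest∈ with ∈-filter⁻ (0ℚ <?_) lowest∈
  ...   | lowest∈d , 0<lowest with ∈-tabulate⁻ lowest∈d
  ...     | v , lowest≡dv = inj₂ (v , subst (0ℚ <_) lowest≡dv 0<lowest , lowest≡dv)

levelDecomposition : ∀ {n s} (d : Fin n → ℚ) → 0ℚ ≤ s → LevelDecomposition s d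
levelDecomposition d 0≤s = decompose d 0≤s (⊂-wellFounded (positives d))
  where
  -- Peeling off the lowest positive value of d removes the vertex where it is attained from the support.
  decompose : ∀ {s} d → 0ℚ ≤ s → Acc _⊂_ (positives d) → LevelDecomposition s d
  decompose {s} d 0≤s (acc smaller) with 0ℚ <? s
  ... | no 0≮s = subst (λ s → LevelDecomposition s d) (sym (≤-antisym (≮⇒≥ 0≮s) 0≤s)) emptyDecomposition
  ... | yes 0<s with lowest-sel s d
  ...   | inj₁ t≡s =
    peelLayer (subst (0ℚ <_) (sym t≡s) 0<s) (lowest≤ s d) (lowest≤positive s d)
      (subst (λ r → LevelDecomposition r (lowerBy (lowest s d) ∘ d))
        (sym (trans (cong (λ r → s - r) t≡s) (+-inverseʳ s))) emptyDecomposition)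
  ...   | inj₂ (v , 0<dv , t≡dv) =
    peelLayer (subst (0ℚ <_) (sym t≡dv) 0<dv) (lowest≤ s d) (lowest≤positive s d)
      (decompose (lowerBy (lowest s d) ∘ d) (p≤q⇒0≤q-p (lowest≤ s d)) (smaller (lowerBy-⊂ 0<dv (sym t≡dv))))

AgreeOn : ∀ {n} → Subset n → Subset n → Subset n → Set
AgreeOn T A B = ∀ {v} → v ∈ T → lookup A v ≡ lookup B v

agreeOn⇒∩≡ : ∀ {n} (T A B : Subset n) → AgreeOn T A B → A ∩ T ≡ B ∩ T
agreeOn⇒∩≡ []            []      []      _     = refl
agreeOn⇒∩≡ (outside ∷ T) (a ∷ A) (b ∷ B) agree =
  cong₂ _∷_ (trans (∧-zeroʳ a) (sym (∧-zeroʳ b))) (agreeOn⇒∩≡ T A B (agree ∘ there))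
agreeOn⇒∩≡ (inside ∷ T)  (a ∷ A) (b ∷ B) agree =
  cong₂ _∷_ (cong (_∧ inside) (agree here)) (agreeOn⇒∩≡ T A B (agree ∘ there))

agreeOn-isTCutShore : ∀ {n} (T A B : Subset n) → AgreeOn T A B → IsTCutShore T B → IsTCutShore T A
agreeOn-isTCutShore T A B agree = subst (Odd ∘ ∣_∣) (sym (agreeOn⇒∩≡ T A B agree))

odd⇒nonempty : ∀ {n} {p : Subset n} → Odd ∣ p ∣ → Nonempty p
odd⇒nonempty {n} {p} odd with nonempty? p
... | yes nonempty = nonempty
... | no  empty    =
  contradiction (subst Odd (∣⊥∣≡0 n) (subst (Odd ∘ ∣_∣) (Empty-unique empty) odd)) λ ()

sideSplit : ∀ m → Fin (2 ℕ.* m) ↔ (Side × Fin m)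
sideSplit m = (2↔Bool ×-↔ ↔-id (Fin m)) ↔-∘ *↔×

-- An index in Fin (2 ^ ∣ T ∣) lists one side per element of T; off T the trace is outside.
trace : ∀ {n} (T : Subset n) → Fin (2 ^ ∣ T ∣) → Subset n
trace []            _ = []
trace (outside ∷ T) i = outside ∷ trace T i
trace (inside  ∷ T) i with Inverse.to (sideSplit (2 ^ ∣ T ∣)) i
... | s , j = s ∷ trace T j

traceIndex : ∀ {n} (T S : Subset n) → Fin (2 ^ ∣ T ∣)
traceIndex []            []      = zero
traceIndex (outside ∷ T) (_ ∷ S) = traceIndex T S
traceIndex (inside  ∷ T) (s ∷ S) = Inverse.from (sideSplit (2 ^ ∣ T ∣)) (s , traceIndex T S)

private
  split-join : ∀ {n} (T : Subset n) s S →
    Inverse.to (sideSplit (2 ^ ∣ T ∣)) (traceIndex (inside ∷ T) (s ∷ S)) ≡ (s , traceIndex T S)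
  split-join T s S = Inverse.strictlyInverseˡ (sideSplit (2 ^ ∣ T ∣)) (s , traceIndex T S)

trace-traceIndex : ∀ {n} (T S : Subset n) → AgreeOn T (trace T (traceIndex T S)) S
trace-traceIndex (outside ∷ T) (_ ∷ S) (there v∈T) = trace-traceIndex T S v∈T
trace-traceIndex (inside  ∷ T) (s ∷ S) here        = cong proj₁ (split-join T s S)
trace-traceIndex (inside  ∷ T) (s ∷ S) (there v∈T) =
  trans (cong (λ i → lookup (trace T (proj₂ i)) _) (split-join T s S)) (trace-traceIndex T S v∈T)

InScaledTCutPolyhedron : ∀ n → Subset n → ℚ → EdgeVec n → Set
InScaledTCutPolyhedron n T a x =
  ∃[ k ] Σ (Fin k → ℚ) λ λs → Σ (Fin k → Subset n) λ S →
      (∀ i → 0ℚ ≤ λs i)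
    × (sumFin λs ≡ a)
    × (∀ i → IsTCutShore T (S i))
    × (∀ e → sumFin (λ i → λs i * cutVec (S i) e) ≤ x e)

module _ {n} {T : Subset n} where

  scaled-mono : ∀ {a x y} → InScaledTCutPolyhedron n T a x → (∀ e → x e ≤ y e) →
    InScaledTCutPolyhedron n T a y
  scaled-mono (k , λs , S , λs≥0 , Σλs , shores , bound) x≤y =
    k , λs , S , λs≥0 , Σλs , shores , λ e → ≤-trans (bound e) (x≤y e)

  scaled-zero : ∀ {x} → (∀ e → 0ℚ ≤ x e) → InScaledTCutPolyhedron n T 0ℚ x
  scaled-zero 0≤x = 0 , (λ ()) , (λ ()) , (λ ()) , refl , (λ ()) , 0≤x

  scaled-+ : ∀ {a b x y} → InScaledTCutPolyhedron n T a x → InScaledTCutPolyhedron n T b y →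
    InScaledTCutPolyhedron n T (a + b) (λ e → x e + y e)
  scaled-+ (k , λs , S , λs≥0 , Σλs , S-shores , S-bound)
           (l , μs , R , μs≥0 , Σμs , R-shores , R-bound) =
    k ℕ.+ l , λs Vector.++ μs , S Vector.++ R ,
    ++-pointwise {P = 0ℚ ≤_} λs≥0 μs≥0 ,
    trans (sumFin-++ λs μs) (cong₂ _+_ Σλs Σμs) ,
    ++-pointwise {P = IsTCutShore T} S-shores R-shores ,
    λ e → subst (_≤ _)
      (sym (trans (sumFin-cong (++-zipWith (λ λ′ S′ → λ′ * cutVec S′ e) λs μs S R))
                  (sumFin-++ (λ i → λs i * cutVec (S i) e) (λ i → μs i * cutVec (R i) e))))
      (+-mono-≤ (S-bound e) (R-bound e))

  scaled-sum : ∀ {k} {a : Fin k → ℚ} {x : Fin k → EdgeVec n} →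
    (∀ U → InScaledTCutPolyhedron n T (a U) (x U)) →
    InScaledTCutPolyhedron n T (sumFin a) (λ e → sumFin (λ U → x U e))
  scaled-sum {zero}  _   = scaled-zero (λ _ → ≤-refl)
  scaled-sum {suc k} x∈ = scaled-+ (x∈ zero) (scaled-sum (x∈ ∘ suc))

differ-sym : ∀ a b → differ a b ≡ differ b a
differ-sym inside  inside  = refl
differ-sym inside  outside = refl
differ-sym outside inside  = refl
differ-sym outside outside = refl

module _ {n} {T R : Subset n} {s : ℚ} {d : Fin n → ℚ} {g : Fin n → Fin n → ℚ}
  (odd    : Odd ∣ R ∩ T ∣)
  (top    : ∀ {v} → v ∈ T → lookup R v ≡ inside → d v ≡ s)
  (bottom : ∀ {v} → v ∈ T → lookup R v ≡ outside → d v ≡ 0ℚ)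
  (above  : ∀ u w → d u - d w ≤ g u w)
  (below  : ∀ u w → d w - d u ≤ g u w)
  where

  levelDecomposition⇒scaled : LevelDecomposition s d → InScaledTCutPolyhedron n T s (λ (u , w , _) → g u w)
  levelDecomposition⇒scaled D =
    depth , weight , layer , weight-nonneg , weight-sum , shore , λ (u , w , _) → cut≤gap u w
    where
    open LevelDecomposition D

    agrees : ∀ i → AgreeOn T (layer i) R
    agrees i {v} v∈T with lookup R v in Rv
    ... | inside  = top∈layer i (top v∈T Rv)
    ... | outside = bottom∉layer i (bottom v∈T Rv)

    shore : ∀ i → IsTCutShore T (layer i)
    shore i = agreeOn-isTCutShore T (layer i) R (agrees i) odd

    cut≤gap : ∀ u w → sumFin (λ i → weight i * differ (lookup (layer i) u) (lookup (layer i) w)) ≤ g u w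
    cut≤gap u w with ≤-total (d w) (d u)
    ... | inj₁ dw≤du = ≤-trans (separation dw≤du) (above u w)
    ... | inj₂ du≤dw = ≤-trans (≤-reflexive (sumFin-cong flip-cut)) (≤-trans (separation du≤dw) (below u w))
      where
      flip-cut : ∀ i → weight i * differ (lookup (layer i) u) (lookup (layer i) w)
                     ≡ weight i * differ (lookup (layer i) w) (lookup (layer i) u)
      flip-cut i = cong (weight i *_) (differ-sym (lookup (layer i) u) (lookup (layer i) w))

indicator : Side → ℚ
indicator inside  = 1ℚ
indicator outside = 0ℚ

indicator-nonneg : ∀ a → 0ℚ ≤ indicator a
indicator-nonneg inside  = *≤* (+≤+ z≤n)
indicator-nonneg outside = ≤-refl

indicator-diff : ∀ a b → indicator a - indicator b ≤ differ a b
indicator-diff inside  inside  = ≤-reflexive (+-inverseʳ 1ℚ)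
indicator-diff inside  outside = ≤-refl
indicator-diff outside inside  = *≤* -≤+
indicator-diff outside outside = ≤-refl

-- Block U homogenises {(d, x) : d ≥ 0, d = χ(U) on T, x_uw ≥ |d_u - d_w|} with the scale λ_U;
-- on even traces the parity equation forces λ_U = 0.
module TCutFormulation {n : ℕ} (T : Subset n) where

  Trace : Set
  Trace = Fin (2 ^ ∣ T ∣)

  OddTrace : Trace → Set
  OddTrace U = Odd ∣ trace T U ∩ T ∣

  oddTrace? : ∀ U → Dec (OddTrace U)
  oddTrace? U = ∣ trace T U ∩ T ∣ ℕ.% 2 ℕ.≟ 1

  BlockVar : Set
  BlockVar = ⊤ ⊎ (Fin n ⊎ (Fin n × Fin n))

  pattern scale   = inj₁ tt
  pattern level v = inj₂ (inj₁ v)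
  pattern gap u w = inj₂ (inj₂ (u , w))

  BlockIneq : Set
  BlockIneq = (Fin n × Fin n) ⊎ ((Fin n × Fin n) ⊎ Fin n)

  pattern above u w = inj₁ (u , w)
  pattern below u w = inj₂ (inj₁ (u , w))
  pattern nonneg v  = inj₂ (inj₂ v)

  blockIneq : BlockIneq → LinearForm BlockVar
  blockIneq (above u w) = var (level u) ⊖ var (level w) ⊖ var (gap u w)
  blockIneq (below u w) = var (level w) ⊖ var (level u) ⊖ var (gap u w)
  blockIneq (nonneg v)  = 0ₗ ⊖ var (level v)

  BlockEq : Set
  BlockEq = ⊤ ⊎ Fin n

  pattern parity   = inj₁ tt
  pattern anchor v = inj₂ v

  parityForm : ∀ {U} → Dec (OddTrace U) → LinearForm BlockVar
  parityForm (yes _) = 0ₗ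
  parityForm (no _)  = var scale

  anchorForm : Side → Side → Fin n → LinearForm BlockVar
  anchorForm inside  inside  v = var (level v) ⊖ var scale
  anchorForm inside  outside v = var (level v)
  anchorForm outside _       v = 0ₗ

  blockEq : Trace → BlockEq → LinearForm BlockVar
  blockEq U parity     = parityForm (oddTrace? U)
  blockEq U (anchor v) = anchorForm (lookup T v) (lookup (trace T U) v) v

  BlockFeasible : Trace → (BlockVar → ℚ) → Set
  BlockFeasible U Z = (∀ r → eval Z (blockIneq r) ≤ 0ℚ) × (∀ r → eval Z (blockEq U r) ≡ 0ℚ)

  gapVector : (BlockVar → ℚ) → EdgeVec n
  gapVector Z (u , w , _) = Z (gap u w)

  formulation : Formulation n
  formulation = record
    { Variable     = Trace × BlockVar
    ; Inequality   = Trace × BlockIneq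
    ; Equation     = ⊤ ⊎ (Trace × BlockEq)
    ; variables    = enumFin _ ×ₑ (enum⊤ ⊎ₑ enumFin n ⊎ₑ enumFin n ×ₑ enumFin n)
    ; inequalities = enumFin _ ×ₑ (enumFin n ×ₑ enumFin n ⊎ₑ enumFin n ×ₑ enumFin n ⊎ₑ enumFin n)
    ; equations    = enum⊤ ⊎ₑ enumFin _ ×ₑ (enum⊤ ⊎ₑ enumFin n)
    ; ineqForm     = λ (U , r) → rename (U ,_) (blockIneq r)
    ; ineqBound    = λ _ → 0ℚ
    ; eqForm       = λ { (inj₁ tt)      → Σₗ (λ U → var (U , scale))
                       ; (inj₂ (U , r)) → rename (U ,_) (blockEq U r) }
    ; eqValue      = λ { (inj₁ tt) → 1ℚ ; (inj₂ _) → 0ℚ }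
    ; image        = λ (u , w , _) → Σₗ (λ U → var (U , gap u w))
    }

  open Formulation formulation using (Feasible; project; extFormulation; represents)

  block : (Trace × BlockVar → ℚ) → Trace → BlockVar → ℚ
  block Y U b = Y (U , b)

  feasible⇒blockFeasible : ∀ {Y} → Feasible Y → ∀ U → BlockFeasible U (block Y U)
  feasible⇒blockFeasible {Y} (ineqs-hold , eqs-hold) U =
    (λ r → subst (_≤ 0ℚ) (eval-rename Y (U ,_) (blockIneq r)) (ineqs-hold (U , r))) ,
    (λ r → trans (sym (eval-rename Y (U ,_) (blockEq U r))) (eqs-hold (inj₂ (U , r))))

  blockFeasible⇒feasible : ∀ {Y} → sumFin (λ U → Y (U , scale)) ≡ 1ℚ → (∀ U → BlockFeasible U (block Y U)) →
    Feasible Y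
  blockFeasible⇒feasible {Y} total blocks =
    (λ (U , r) → subst (_≤ 0ℚ) (sym (eval-rename Y (U ,_) (blockIneq r))) (proj₁ (blocks U) r)) ,
    λ { (inj₁ tt)      → trans (eval-Σₗ Y (λ U → var (U , scale))) total
      ; (inj₂ (U , r)) → trans (eval-rename Y (U ,_) (blockEq U r)) (proj₂ (blocks U) r) }

  module BlockSoundness (U : Trace) (Z : BlockVar → ℚ) (feasible : BlockFeasible U Z) where

    level-nonneg : ∀ v → 0ℚ ≤ Z (level v)
    level-nonneg v = p-q≤0⇒p≤q (proj₁ feasible (nonneg v))

    gap-above : ∀ u w → Z (level u) - Z (level w) ≤ Z (gap u w)
    gap-above u w = p-q≤0⇒p≤q (proj₁ feasible (above u w))

    gap-below : ∀ u w → Z (level w) - Z (level u) ≤ Z (gap u w)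
    gap-below u w = p-q≤0⇒p≤q (proj₁ feasible (below u w))

    gap-nonneg : ∀ u w → 0ℚ ≤ Z (gap u w)
    gap-nonneg u w with ≤-total (Z (level w)) (Z (level u))
    ... | inj₁ w≤u = ≤-trans (p≤q⇒0≤q-p w≤u) (gap-above u w)
    ... | inj₂ u≤w = ≤-trans (p≤q⇒0≤q-p u≤w) (gap-below u w)

    anchored : ∀ {v} → v ∈ T → eval Z (anchorForm inside (lookup (trace T U) v) v) ≡ 0ℚ
    anchored {v} v∈T =
      subst (λ a → eval Z (anchorForm a (lookup (trace T U) v) v) ≡ 0ℚ) ([]=⇒lookup v∈T)
            (proj₂ feasible (anchor v))

    level-top : ∀ {v} → v ∈ T → lookup (trace T U) v ≡ inside → Z (level v) ≡ Z scale
    level-top {v} v∈T in-trace =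
      p-q≡0⇒p≡q (subst (λ b → eval Z (anchorForm inside b v) ≡ 0ℚ) in-trace (anchored v∈T))

    level-bottom : ∀ {v} → v ∈ T → lookup (trace T U) v ≡ outside → Z (level v) ≡ 0ℚ
    level-bottom {v} v∈T off-trace =
      subst (λ b → eval Z (anchorForm inside b v) ≡ 0ℚ) off-trace (anchored v∈T)

    even⇒scale≡0 : ¬ OddTrace U → Z scale ≡ 0ℚ
    even⇒scale≡0 even with oddTrace? U | proj₂ feasible parity
    ... | yes odd | _       = contradiction odd even
    ... | no  _   | scale≡0 = scale≡0

    odd⇒scale-nonneg : OddTrace U → 0ℚ ≤ Z scale
    odd⇒scale-nonneg odd with odd⇒nonempty odd
    ... | v , v∈trace∩T with x∈p∩q⁻ (trace T U) T v∈trace∩T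
    ...   | v∈trace , v∈T = subst (0ℚ ≤_) (level-top v∈T ([]=⇒lookup v∈trace)) (level-nonneg v)

    scaled : InScaledTCutPolyhedron n T (Z scale) (gapVector Z)
    scaled with oddTrace? U
    ... | no even = subst (λ a → InScaledTCutPolyhedron n T a (gapVector Z)) (sym (even⇒scale≡0 even))
                      (scaled-zero (λ (u , w , _) → gap-nonneg u w))
    ... | yes odd = levelDecomposition⇒scaled {R = trace T U} odd level-top level-bottom gap-above gap-below
                      (levelDecomposition (Z ∘ level) (odd⇒scale-nonneg odd))

  shoreLift : (Fin n → Fin n → ℚ) → Subset n → BlockVar → ℚ
  shoreLift slack S scale     = 1ℚ
  shoreLift slack S (level v) = indicator (lookup S v)
  shoreLift slack S (gap u w) = differ (lookup S u) (lookup S w) + slack u w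

  shoreLift-feasible : ∀ {slack S} → (∀ u w → 0ℚ ≤ slack u w) → IsTCutShore T S →
    BlockFeasible (traceIndex T S) (shoreLift slack S)
  shoreLift-feasible {slack} {S} slack≥0 shore = ineqs-hold , eqs-hold
    where
    cut : Fin n → Fin n → ℚ
    cut u w = differ (lookup S u) (lookup S w)

    cut≤gap : ∀ u w → cut u w ≤ cut u w + slack u w
    cut≤gap u w = subst (_≤ cut u w + slack u w) (+-identityʳ (cut u w)) (+-monoʳ-≤ (cut u w) (slack≥0 u w))

    ineqs-hold : ∀ r → eval (shoreLift slack S) (blockIneq r) ≤ 0ℚ
    ineqs-hold (above u w) = p≤q⇒p-q≤0 (≤-trans (indicator-diff (lookup S u) (lookup S w)) (cut≤gap u w))
    ineqs-hold (below u w) = p≤q⇒p-q≤0 (≤-trans (indicator-diff (lookup S w) (lookup S u))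
      (subst (_≤ cut u w + slack u w) (differ-sym (lookup S u) (lookup S w)) (cut≤gap u w)))
    ineqs-hold (nonneg v)  = p≤q⇒p-q≤0 (indicator-nonneg (lookup S v))

    eqs-hold : ∀ r → eval (shoreLift slack S) (blockEq (traceIndex T S) r) ≡ 0ℚ
    eqs-hold parity with oddTrace? (traceIndex T S)
    ... | yes _   = refl
    ... | no even =
      contradiction (agreeOn-isTCutShore T (trace T (traceIndex T S)) S (trace-traceIndex T S) shore) even
    eqs-hold (anchor v) with lookup T v in v∈T
    ... | outside = refl
    ... | inside rewrite trace-traceIndex T S (lookup⇒[]= v T v∈T) with lookup S v in v∈S
    ...   | inside  = trans (cong (λ a → indicator a - 1ℚ) v∈S) (+-inverseʳ 1ℚ)
    ...   | outside = cong indicator v∈S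

  -- As Σ μ = 1, x = Σᵢ μ i · (χ(δ(S i)) + slack), and the i-th summand lifts into block traceIndex T (S i).
  module Lift (x : EdgeVec n) {k} (μ : Fin k → ℚ) (S : Fin k → Subset n)
    (μ≥0 : ∀ i → 0ℚ ≤ μ i) (Σμ≡1 : sumFin μ ≡ 1ℚ) (shores : ∀ i → IsTCutShore T (S i))
    (dominated : ∀ e → sumFin (λ i → μ i * cutVec (S i) e) ≤ x e) where

    cutSum : Fin n → Fin n → ℚ
    cutSum u w = sumFin (λ i → μ i * differ (lookup (S i) u) (lookup (S i) w))

    slack : Fin n → Fin n → ℚ
    slack u w with u Fin.<? w
    ... | yes u<w = x (u , w , u<w) - cutSum u w
    ... | no  _   = 0ℚ

    slack-nonneg : ∀ u w → 0ℚ ≤ slack u w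
    slack-nonneg u w with u Fin.<? w
    ... | yes u<w = p≤q⇒0≤q-p (dominated (u , w , u<w))
    ... | no  _   = ≤-refl

    cutSum+slack : ∀ u w (u<w : u Fin.< w) → cutSum u w + slack u w ≡ x (u , w , u<w)
    cutSum+slack u w u<w with u Fin.<? w
    ... | yes u<w′ = trans (solve 2 (λ c y → c :+ (y :- c) := y) refl (cutSum u w) (x (u , w , u<w′)))
                           (cong (λ p → x (u , w , p)) (<-irrelevant u<w′ u<w))
    ... | no  u≮w  = contradiction u<w u≮w

    blockWeight : Trace → Fin k → ℚ
    blockWeight U i = δ (traceIndex T (S i)) U * μ i

    lifted : Trace × BlockVar → ℚ
    lifted (U , b) = sumFin (λ i → shoreLift slack (S i) b * blockWeight U i)

    sumFin-blockWeight : ∀ (g : Fin k → ℚ) →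
      sumFin (λ U → sumFin (λ i → g i * blockWeight U i)) ≡ sumFin (λ i → g i * μ i)
    sumFin-blockWeight g = trans (sumFin-comm (λ U i → g i * blockWeight U i)) (sumFin-cong single-block)
      where
      single-block : ∀ i → sumFin (λ U → g i * blockWeight U i) ≡ g i * μ i
      single-block i =
        trans (sumFin-cong (λ U → solve 3 (λ a b c → a :* (b :* c) := b :* (a :* c)) refl
                                      (g i) (δ (traceIndex T (S i)) U) (μ i)))
              (sumFin-δ (traceIndex T (S i)) (λ _ → g i * μ i))

    lifted-blockFeasible : ∀ U → BlockFeasible U (block lifted U)
    lifted-blockFeasible U = ineqs-hold , eqs-hold
      where
      ineqs-hold : ∀ r → eval (block lifted U) (blockIneq r) ≤ 0ℚ
      ineqs-hold r =
        ≤-trans (≤-reflexive (eval-linear (λ i → shoreLift slack (S i)) (blockWeight U) (blockIneq r)))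
                (≤-trans (sumFin-mono term≤0) (≤-reflexive (sumFin-zero {k})))
        where
        term≤0 : ∀ i → eval (shoreLift slack (S i)) (blockIneq r) * blockWeight U i ≤ 0ℚ
        term≤0 i with traceIndex T (S i) Fin.≟ U
        ... | yes refl = p≤0⇒0≤q⇒p*q≤0 (proj₁ (shoreLift-feasible slack-nonneg (shores i)) r)
                                       (subst (0ℚ ≤_) (sym (*-identityˡ (μ i))) (μ≥0 i))
        ... | no  _    = ≤-reflexive (trans (cong (eval (shoreLift slack (S i)) (blockIneq r) *_) (*-zeroˡ (μ i)))
                                            (*-zeroʳ (eval (shoreLift slack (S i)) (blockIneq r))))

      eqs-hold : ∀ r → eval (block lifted U) (blockEq U r) ≡ 0ℚ
      eqs-hold r = trans (eval-linear (λ i → shoreLift slack (S i)) (blockWeight U) (blockEq U r))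
                     (trans (sumFin-cong term≡0) (sumFin-zero {k}))
        where
        term≡0 : ∀ i → eval (shoreLift slack (S i)) (blockEq U r) * blockWeight U i ≡ 0ℚ
        term≡0 i with traceIndex T (S i) Fin.≟ U
        ... | yes refl = trans (cong (_* (1ℚ * μ i)) (proj₂ (shoreLift-feasible slack-nonneg (shores i)) r))
                               (*-zeroˡ (1ℚ * μ i))
        ... | no  _    = trans (cong (eval (shoreLift slack (S i)) (blockEq U r) *_) (*-zeroˡ (μ i)))
                               (*-zeroʳ (eval (shoreLift slack (S i)) (blockEq U r)))

    lifted-total : sumFin (λ U → lifted (U , scale)) ≡ 1ℚ
    lifted-total = trans (sumFin-blockWeight (λ _ → 1ℚ)) (trans (sumFin-cong (λ i → *-identityˡ (μ i))) Σμ≡1)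

    lifted-projects : ∀ e → project lifted e ≡ x e
    lifted-projects (u , w , u<w) = begin
      eval lifted (Σₗ (λ U → var (U , gap u w)))
        ≡⟨ eval-Σₗ lifted (λ U → var (U , gap u w)) ⟩
      sumFin (λ U → lifted (U , gap u w))
        ≡⟨ sumFin-blockWeight (λ i → shoreLift slack (S i) (gap u w)) ⟩
      sumFin (λ i → (differ (lookup (S i) u) (lookup (S i) w) + slack u w) * μ i)
        ≡⟨ sumFin-cong (λ i → solve 3 (λ c s m → (c :+ s) :* m := m :* c :+ s :* m) refl
                                       (differ (lookup (S i) u) (lookup (S i) w)) (slack u w) (μ i)) ⟩
      sumFin (λ i → μ i * differ (lookup (S i) u) (lookup (S i) w) + slack u w * μ i)
        ≡⟨ sumFin-+ {k} _ _ ⟩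
      cutSum u w + sumFin (λ i → slack u w * μ i)
        ≡⟨ cong (cutSum u w +_) (trans (sumFin-*ˡ (slack u w) μ)
                                       (trans (cong (slack u w *_) Σμ≡1) (*-identityʳ (slack u w)))) ⟩
      cutSum u w + slack u w
        ≡⟨ cutSum+slack u w u<w ⟩
      x (u , w , u<w) ∎
      where open ≡-Reasoning

    complete : ∃[ Y ] Feasible Y × (∀ e → project Y e ≡ x e)
    complete = lifted , blockFeasible⇒feasible lifted-total lifted-blockFeasible , lifted-projects

  project∈P : ∀ Y → Feasible Y → InTCutPolyhedron n T (project Y)
  project∈P Y feasible =
    scaled-mono (subst (λ a → InScaledTCutPolyhedron n T a (λ e → sumFin (λ U → gapVector (block Y U) e))) total
                       (scaled-sum blocks))
                (λ (u , w , _) → ≤-reflexive (sym (eval-Σₗ Y (λ U → var (U , gap u w)))))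
    where
    blocks : ∀ U → InScaledTCutPolyhedron n T (Y (U , scale)) (gapVector (block Y U))
    blocks U = BlockSoundness.scaled U (block Y U) (feasible⇒blockFeasible feasible U)

    total : sumFin (λ U → Y (U , scale)) ≡ 1ℚ
    total = trans (sym (eval-Σₗ Y (λ U → var (U , scale)))) (proj₂ feasible (inj₁ tt))

  extFormulation-represents : Represents extFormulation (InTCutPolyhedron n T)
  extFormulation-represents = represents
    (λ x≗x′ x∈P → scaled-mono x∈P (≤-reflexive ∘ x≗x′))
    (λ x (_ , μ , S , μ≥0 , Σμ≡1 , shores , dominated) → Lift.complete x μ S μ≥0 Σμ≡1 shores dominated)
    project∈P

rowCount≤ : ∀ m n → m ℕ.* (n ℕ.* n ℕ.+ (n ℕ.* n ℕ.+ n)) ℕ.≤ 3 ℕ.* n ^ 2 ℕ.* m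
rowCount≤ m n = begin
  m ℕ.* (n ℕ.* n ℕ.+ (n ℕ.* n ℕ.+ n))
    ≤⟨ ℕ.*-monoʳ-≤ m (ℕ.+-monoʳ-≤ (n ℕ.* n) (ℕ.+-monoʳ-≤ (n ℕ.* n) (n≤n*n n))) ⟩
  m ℕ.* (n ℕ.* n ℕ.+ (n ℕ.* n ℕ.+ n ℕ.* n))
    ≡⟨ rearrange m n ⟩
  3 ℕ.* (n ℕ.* n) ℕ.* m
    ≡⟨ cong (λ k → 3 ℕ.* (n ℕ.* k) ℕ.* m) (ℕ.*-identityʳ n) ⟨
  3 ℕ.* n ^ 2 ℕ.* m
    ∎
  where
  open ℕ.≤-Reasoning
  n≤n*n : ∀ n → n ℕ.≤ n ℕ.* n
  n≤n*n zero      = z≤n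
  n≤n*n n@(suc _) = ℕ.m≤m*n n n
  rearrange : ∀ m n → m ℕ.* (n ℕ.* n ℕ.+ (n ℕ.* n ℕ.+ n ℕ.* n)) ≡ 3 ℕ.* (n ℕ.* n) ℕ.* m
  rearrange = solve-∀

corollary12 : ∃[ C ] ∀ (n : ℕ) (T : Subset n) → XcAtMost (InTCutPolyhedron n T) (C ℕ.* n ^ 2 ℕ.* 2 ^ ∣ T ∣)
corollary12 = 3 , λ n T →
  Formulation.extFormulation (TCutFormulation.formulation T) ,
  TCutFormulation.extFormulation-represents T ,
  rowCount≤ (2 ^ ∣ T ∣) n
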